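{- Let $G=(V,E)$ be a finite undirected graph and $s>1$ with $|E|\le s|V|$. Let $\vec G=(V,\vec E)$ be the output of the following procedure with parameter $t=2s$: orient every edge arbitrarily; while there exists $(u,v)\in\vec E$ with $d^{\mathrm{out}}_u(\vec E)\ge t$ and $d^{\mathrm{out}}_v(\vec E)<t-1$, reverse $(u,v)$. Let $\vec E_r\subset\vec E$ be obtained by removing from $\vec E$ all $(u,v)$ with $d^{\mathrm{out}}_u(\vec E)<2s$, and let $V_r(\vec E_r)$ be the set of vertices incident to edges of $\vec E_r$. Then $|V_r(\vec E_r)|\le|V|/(2-1/s)$.
   Context: For a set $\vec F$ of directed edges, $d^{\mathrm{out}}_u(\vec F)=|\{v:(u,v)\in\vec F\}|$.
   Formalization: The parameter s ranges over the rationals greater than 1. -}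

module Defs where

open import Data.Nat using (ℕ; zero; suc)
import Data.Nat as ℕ
open import Data.Fin using (Fin; toℕ)
import Data.Fin as Fin
open import Data.Bool using (Bool; true; false; _∧_; _∨_; if_then_else_)
open import Data.Product using (_×_; Σ; ∃)
open import Data.Sum using (_⊎_)
open import Data.Integer using (+_)
open import Data.Rational using (ℚ; _/_; _≤_; _<_; _+_; _-_; _*_; 1ℚ)
open import Data.Rational.Properties using (_≤?_)
open import Relation.Nullary using (¬_)
open import Relation.Nullary.Decidable using (⌊_⌋)
open import Relation.Binary.PropositionalEquality using (_≡_)
open import Relation.Binary.Construct.Closure.ReflexiveTransitive using (Star)

ℕtoℚ : ℕ → ℚ
ℕtoℚ n = + n / 1

countTrue : ∀ {n} → (Fin n → Bool) → ℕ
countTrue {zero} f = 0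
countTrue {suc n} f = (if f Fin.zero then 1 else 0) ℕ.+ countTrue (λ i → f (Fin.suc i))

anyTrue : ∀ {n} → (Fin n → Bool) → Bool
anyTrue {zero} f = false
anyTrue {suc n} f = f Fin.zero ∨ anyTrue (λ i → f (Fin.suc i))

sumℕ : ∀ {n} → (Fin n → ℕ) → ℕ
sumℕ {zero} f = 0
sumℕ {suc n} f = f Fin.zero ℕ.+ sumℕ (λ i → f (Fin.suc i))

record Graph (n : ℕ) : Set where
  field
    adj   : Fin n → Fin n → Bool
    sym   : ∀ u v → adj u v ≡ adj v u
    irrefl : ∀ u → adj u u ≡ false
open Graph public

numEdges : ∀ {n} → Graph n → ℕ
numEdges {n} G = sumℕ (λ u → countTrue (λ v → ⌊ toℕ u ℕ.<? toℕ v ⌋ ∧ adj G u v))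

DiEdges : ℕ → Set
DiEdges n = Fin n → Fin n → Bool

IsOrientation : ∀ {n} → Graph n → DiEdges n → Set
IsOrientation {n} G D =
  (∀ u v → D u v ≡ true → adj G u v ≡ true) ×
  (∀ u v → adj G u v ≡ true → (D u v ≡ true) ⊎ (D v u ≡ true)) ×
  (∀ u v → ¬ ((D u v ≡ true) × (D v u ≡ true)))

dout : ∀ {n} → DiEdges n → Fin n → ℕ
dout D u = countTrue (D u)

reverse : ∀ {n} → Fin n → Fin n → DiEdges n → DiEdges n
reverse u v D x y =
  if ⌊ x Fin.≟ u ⌋ ∧ ⌊ y Fin.≟ v ⌋ then false
  else if ⌊ x Fin.≟ v ⌋ ∧ ⌊ y Fin.≟ u ⌋ then true
  else D x y

Reversible : ∀ {n} → ℚ → DiEdges n → Fin n → Fin n → Set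
Reversible t D u v =
  (D u v ≡ true) × (t ≤ ℕtoℚ (dout D u)) × (ℕtoℚ (dout D v) < t - 1ℚ)

Step : ∀ {n} → ℚ → DiEdges n → DiEdges n → Set
Step t D D' = Σ _ λ u → Σ _ λ v → Reversible t D u v × (D' ≡ reverse u v D)

-- D is a possible output of the procedure with parameter t on G:
-- reachable by a finite sequence of reversals from an (arbitrary) orientation of G,
-- and no reversible edge remains
IsOutput : ∀ {n} → Graph n → ℚ → DiEdges n → Set
IsOutput G t D =
  (Σ _ λ D₀ → IsOrientation G D₀ × Star (Step t) D₀ D) ×
  (∀ u v → ¬ Reversible t D u v)

inEr : ∀ {n} → ℚ → DiEdges n → Fin n → Fin n → Bool
inEr s D u v = D u v ∧ ⌊ (s + s) ≤? ℕtoℚ (dout D u) ⌋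

inVr : ∀ {n} → ℚ → DiEdges n → Fin n → Bool
inVr s D w = anyTrue (λ x → inEr s D w x ∨ inEr s D x w)

sizeVr : ∀ {n} → ℚ → DiEdges n → ℕ
sizeVr s D = countTrue (inVr s D)

-- Every w ∈ V_r has out-degree ≥ 2s − 1: either w is the tail of a heavy edge,
-- so its out-degree is even ≥ 2s, or w is the head of a heavy edge (x,w); since the
-- procedure has stopped, (x,w) is not reversible, i.e. d^out_w ≥ 2s − 1.  Hence
-- |V_r| · (2s − 1) ≤ Σ_w d^out_w.  Every reversal keeps the directed edges a partial
-- orientation of G (a set of edges of G, each in at most one direction), so the sum
-- of out-degrees is at most |E| ≤ s|V|.
module Submission where

open import Defs
open import Data.Nat using (ℕ; zero; suc)
import Data.Nat as ℕ
import Data.Nat.Properties as ℕP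
import Data.Nat.Coprimality as Coprime
open import Data.Integer using (+_)
import Data.Integer as ℤ
import Data.Integer.Properties as ℤP
open import Data.Rational using (ℚ; mkℚ; _≤_; _<_; _+_; _-_; _*_; 1ℚ; *≤*)
import Data.Rational as ℚ
open import Data.Rational.Properties
  using (normalize-coprime; ≤-trans; ≤-reflexive; ≮⇒≥; +-mono-≤; +-monoʳ-≤;
         +-identityʳ; *-zeroˡ; *-identityˡ; *-distribʳ-+; _≤?_; module ≤-Reasoning)
open import Data.Fin using (Fin; toℕ)
import Data.Fin as Fin
import Data.Fin.Properties as FinP
open import Data.Bool using (Bool; true; false; _∧_; _∨_; if_then_else_)
open import Data.Product using (_×_; Σ; _,_)
open import Data.Sum using (_⊎_; inj₁; inj₂)
open import Data.Empty using (⊥-elim)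
open import Function using (_∘_)
open import Relation.Nullary using (¬_; yes; no)
open import Relation.Nullary.Decidable using (⌊_⌋)
open import Relation.Binary.PropositionalEquality
  using (_≡_; refl; trans; cong; cong₂; subst; subst₂; module ≡-Reasoning)
  renaming (sym to ≡-sym)
open import Relation.Binary.Construct.Closure.ReflexiveTransitive using (Star; ε; _◅_)
open import Algebra.Properties.CommutativeMonoid.Sum ℕP.+-0-commutativeMonoid
  using (sum; sum-cong-≗; ∑-distrib-+; ∑-comm)

-- ℕtoℚ n is the already-normalised fraction n/1; this exposes its numerator and
-- denominator to the definitions of + and ≤ on ℚ.
ℕtoℚ≡mkℚ : ∀ n → ℕtoℚ n ≡ mkℚ (+ n) 0 (Coprime.sym (Coprime.1-coprimeTo n))
ℕtoℚ≡mkℚ n = normalize-coprime (Coprime.sym (Coprime.1-coprimeTo n))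

ℕtoℚ-+ : ∀ a b → ℕtoℚ (a ℕ.+ b) ≡ ℕtoℚ a + ℕtoℚ b
ℕtoℚ-+ a b rewrite ℕtoℚ≡mkℚ a | ℕtoℚ≡mkℚ b =
  cong (λ z → z ℚ./ 1) (≡-sym (cong₂ ℤ._+_ (ℤP.*-identityʳ (+ a)) (ℤP.*-identityʳ (+ b))))

ℕtoℚ-mono : ∀ {a b} → a ℕ.≤ b → ℕtoℚ a ≤ ℕtoℚ b
ℕtoℚ-mono {a} {b} a≤b rewrite ℕtoℚ≡mkℚ a | ℕtoℚ≡mkℚ b =
  *≤* (subst₂ ℤ._≤_ (≡-sym (ℤP.*-identityʳ (+ a))) (≡-sym (ℤP.*-identityʳ (+ b))) (ℤ.+≤+ a≤b))

ℕtoℚ-suc-* : ∀ (c : ℚ) k → ℕtoℚ (suc k) * c ≡ c + ℕtoℚ k * c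
ℕtoℚ-suc-* c k = trans (cong (_* c) (ℕtoℚ-+ 1 k))
  (trans (*-distribʳ-+ c 1ℚ (ℕtoℚ k)) (cong (_+ ℕtoℚ k * c) (*-identityˡ c)))

minus-one-≤ : ∀ p → p - 1ℚ ≤ p
minus-one-≤ p = ≤-trans (+-monoʳ-≤ p (*≤* ℤ.-≤+)) (≤-reflexive (+-identityʳ p))

iverson : Bool → ℕ
iverson b = if b then 1 else 0

sumℕ≡sum : ∀ {n} (f : Fin n → ℕ) → sumℕ f ≡ sum f
sumℕ≡sum {zero} f = refl
sumℕ≡sum {suc n} f = cong (f Fin.zero ℕ.+_) (sumℕ≡sum (f ∘ Fin.suc))

countTrue≡sum : ∀ {n} (p : Fin n → Bool) → countTrue p ≡ sum (iverson ∘ p)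
countTrue≡sum {zero} p = refl
countTrue≡sum {suc n} p = cong (iverson (p Fin.zero) ℕ.+_) (countTrue≡sum (p ∘ Fin.suc))

sum-mono : ∀ {n} {f g : Fin n → ℕ} → (∀ i → f i ℕ.≤ g i) → sum f ℕ.≤ sum g
sum-mono {zero} f≤g = ℕ.z≤n
sum-mono {suc n} f≤g = ℕP.+-mono-≤ (f≤g Fin.zero) (sum-mono (f≤g ∘ Fin.suc))

count-weighted : ∀ {n} (c : ℚ) (p : Fin n → Bool) (d : Fin n → ℕ) →
  (∀ w → p w ≡ true → c ≤ ℕtoℚ (d w)) → ℕtoℚ (countTrue p) * c ≤ ℕtoℚ (sum d)
count-weighted {zero} c p d heavy = ≤-reflexive (*-zeroˡ c)
count-weighted {suc n} c p d heavy
  with p Fin.zero in p₀ | count-weighted c (p ∘ Fin.suc) (d ∘ Fin.suc) (heavy ∘ Fin.suc)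
... | true  | ih = subst₂ _≤_ (≡-sym (ℕtoℚ-suc-* c (countTrue (p ∘ Fin.suc))))
                   (≡-sym (ℕtoℚ-+ (d Fin.zero) (sum (d ∘ Fin.suc))))
                   (+-mono-≤ (heavy Fin.zero p₀) ih)
... | false | ih = ≤-trans ih (ℕtoℚ-mono (ℕP.m≤n+m (sum (d ∘ Fin.suc)) (d Fin.zero)))

lt : ∀ {n} → Fin n → Fin n → Bool
lt u v = ⌊ toℕ u ℕ.<? toℕ v ⌋

upper : ∀ {n} → (Fin n → Fin n → ℕ) → Fin n → Fin n → ℕ
upper f u v = if lt u v then f u v else 0

split-off-diagonal : ∀ {n} (f : Fin n → Fin n → ℕ) → (∀ u → f u u ≡ 0) →
  ∀ u v → f u v ≡ upper f u v ℕ.+ upper (λ x y → f y x) v u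
split-off-diagonal f diag u v with toℕ u ℕ.<? toℕ v | toℕ v ℕ.<? toℕ u
... | yes u<v | yes v<u = ⊥-elim (ℕP.<-asym u<v v<u)
... | yes _   | no _    = ≡-sym (ℕP.+-identityʳ (f u v))
... | no _    | yes _   = refl
... | no u≮v  | no v≮u  = subst (λ w → f u w ≡ 0) u≡v (diag u)
  where
  u≡v : u ≡ v
  u≡v = FinP.toℕ-injective (ℕP.≤-antisym (ℕP.≮⇒≥ v≮u) (ℕP.≮⇒≥ u≮v))

upper-+ : ∀ {n} (f g : Fin n → Fin n → ℕ) u v →
  upper f u v ℕ.+ upper g u v ≡ upper (λ x y → f x y ℕ.+ g x y) u v
upper-+ f g u v with lt u v
... | true  = refl
... | false = refl

sum-ordered-pairs : ∀ {n} (f : Fin n → Fin n → ℕ) → (∀ u → f u u ≡ 0) →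
  sum (λ u → sum (f u)) ≡ sum (λ u → sum (upper (λ x y → f x y ℕ.+ f y x) u))
sum-ordered-pairs {n} f diag = begin
  sum (λ u → sum (f u))
    ≡⟨ sum-cong-≗ (λ u → sum-cong-≗ (split-off-diagonal f diag u)) ⟩
  sum (λ u → sum (λ v → upper f u v ℕ.+ upper fᵀ v u))
    ≡⟨ sum-cong-≗ (λ u → ∑-distrib-+ (upper f u) (λ v → upper fᵀ v u)) ⟩
  sum (λ u → sum (upper f u) ℕ.+ sum (λ v → upper fᵀ v u))
    ≡⟨ ∑-distrib-+ (λ u → sum (upper f u)) (λ u → sum (λ v → upper fᵀ v u)) ⟩
  sum (λ u → sum (upper f u)) ℕ.+ sum (λ u → sum (λ v → upper fᵀ v u))
    ≡⟨ cong (sum (λ u → sum (upper f u)) ℕ.+_) (∑-comm (λ u v → upper fᵀ v u)) ⟩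
  sum (λ u → sum (upper f u)) ℕ.+ sum (λ u → sum (upper fᵀ u))
    ≡⟨ ≡-sym (∑-distrib-+ (λ u → sum (upper f u)) (λ u → sum (upper fᵀ u))) ⟩
  sum (λ u → sum (upper f u) ℕ.+ sum (upper fᵀ u))
    ≡⟨ sum-cong-≗ (λ u → ≡-sym (∑-distrib-+ (upper f u) (upper fᵀ u))) ⟩
  sum (λ u → sum (λ v → upper f u v ℕ.+ upper fᵀ u v))
    ≡⟨ sum-cong-≗ (λ u → sum-cong-≗ (upper-+ f fᵀ u)) ⟩
  sum (λ u → sum (upper (λ x y → f x y ℕ.+ f y x) u)) ∎
  where
  open ≡-Reasoning
  fᵀ : Fin n → Fin n → ℕ
  fᵀ x y = f y x

-- A partial orientation of G: every directed edge is an edge of G, and no edge is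
-- present in both directions.  This is the invariant maintained by the procedure.
record IsPartialOrientation {n} (G : Graph n) (D : DiEdges n) : Set where
  field
    ⊆adj    : ∀ u v → D u v ≡ true → adj G u v ≡ true
    antisym : ∀ u v → ¬ ((D u v ≡ true) × (D v u ≡ true))
open IsPartialOrientation

true≢false : ¬ (true ≡ false)
true≢false ()

orientation⇒partial : ∀ {n} {G : Graph n} {D : DiEdges n} →
  IsOrientation G D → IsPartialOrientation G D
orientation⇒partial (⊆G , _ , anti) = record { ⊆adj = ⊆G ; antisym = anti }

no-loops : ∀ {n} {G : Graph n} {D : DiEdges n} → IsPartialOrientation G D →
  ∀ u → D u u ≡ false
no-loops {G = G} {D} po u with D u u in Duu
... | true  = ⊥-elim (true≢false (trans (≡-sym (⊆adj po u u Duu)) (irrefl G u)))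
... | false = refl

reverse-true-elsewhere : ∀ {n} (u v : Fin n) (D : DiEdges n) x y → ¬ ((x ≡ u) × (y ≡ v)) →
  (if ⌊ x Fin.≟ v ⌋ ∧ ⌊ y Fin.≟ u ⌋ then true else D x y) ≡ true →
  ((x ≡ v) × (y ≡ u)) ⊎ ((D x y ≡ true) × ¬ ((x ≡ u) × (y ≡ v)))
reverse-true-elsewhere u v D x y ≢uv rev with x Fin.≟ v | y Fin.≟ u
... | yes x≡v | yes y≡u = inj₁ (x≡v , y≡u)
... | yes _   | no _    = inj₂ (rev , ≢uv)
... | no _    | _       = inj₂ (rev , ≢uv)

reverse-true : ∀ {n} (u v : Fin n) (D : DiEdges n) x y → reverse u v D x y ≡ true →
  ((x ≡ v) × (y ≡ u)) ⊎ ((D x y ≡ true) × ¬ ((x ≡ u) × (y ≡ v)))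
reverse-true u v D x y rev with x Fin.≟ u | y Fin.≟ v
... | yes _   | yes _   = ⊥-elim (true≢false (≡-sym rev))
... | yes _   | no y≢v  = reverse-true-elsewhere u v D x y (λ (_ , y≡v) → y≢v y≡v) rev
... | no x≢u  | _       = reverse-true-elsewhere u v D x y (λ (x≡u , _) → x≢u x≡u) rev

reverse-preserves : ∀ {n} {G : Graph n} {D : DiEdges n} u v →
  IsPartialOrientation G D → D u v ≡ true → IsPartialOrientation G (reverse u v D)
reverse-preserves {G = G} {D} u v po Duv = record { ⊆adj = ⊆adj′ ; antisym = antisym′ }
  where
  u≢v : ¬ (u ≡ v)
  u≢v refl = true≢false (trans (≡-sym Duv) (no-loops po u))
  ⊆adj′ : ∀ x y → reverse u v D x y ≡ true → adj G x y ≡ true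
  ⊆adj′ x y rev with reverse-true u v D x y rev
  ... | inj₁ (refl , refl) = trans (Graph.sym G v u) (⊆adj po u v Duv)
  ... | inj₂ (Dxy , _)     = ⊆adj po x y Dxy
  antisym′ : ∀ x y → ¬ ((reverse u v D x y ≡ true) × (reverse u v D y x ≡ true))
  antisym′ x y (rev₁ , rev₂) with reverse-true u v D x y rev₁ | reverse-true u v D y x rev₂
  ... | inj₁ (refl , refl) | inj₁ (u≡v , _)     = u≢v u≡v
  ... | inj₁ (refl , refl) | inj₂ (_ , ≢uv)     = ≢uv (refl , refl)
  ... | inj₂ (_ , ≢uv)     | inj₁ (refl , refl) = ≢uv (refl , refl)
  ... | inj₂ (Dxy , _)     | inj₂ (Dyx , _)     = antisym po x y (Dxy , Dyx)

run-preserves : ∀ {n} {G : Graph n} t {D₀ D : DiEdges n} →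
  IsPartialOrientation G D₀ → Star (Step t) D₀ D → IsPartialOrientation G D
run-preserves t po ε = po
run-preserves t po ((u , v , (Duv , _) , refl) ◅ run) =
  run-preserves t (reverse-preserves u v po Duv) run

edge-counted-once : ∀ {n} {G : Graph n} {D : DiEdges n} → IsPartialOrientation G D →
  ∀ u v → iverson (D u v) ℕ.+ iverson (D v u) ℕ.≤ iverson (adj G u v)
edge-counted-once {G = G} {D} po u v with D u v in Duv | D v u in Dvu | adj G u v in Guv
... | true  | true  | _     = ⊥-elim (antisym po u v (Duv , Dvu))
... | true  | false | true  = ℕP.≤-refl
... | false | true  | true  = ℕP.≤-refl
... | false | false | _     = ℕ.z≤n
... | true  | false | false = ⊥-elim (true≢false (trans (≡-sym (⊆adj po u v Duv)) Guv))
... | false | true  | false =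
  ⊥-elim (true≢false (trans (≡-sym (trans (Graph.sym G u v) (⊆adj po v u Dvu))) Guv))

degree-sum-bound : ∀ {n} {G : Graph n} {D : DiEdges n} → IsPartialOrientation G D →
  sum (dout D) ℕ.≤ numEdges G
degree-sum-bound {G = G} {D} po = begin
  sum (dout D)
    ≡⟨ sum-cong-≗ (λ u → countTrue≡sum (D u)) ⟩
  sum (λ u → sum (λ v → iverson (D u v)))
    ≡⟨ sum-ordered-pairs (λ u v → iverson (D u v)) (λ u → cong iverson (no-loops po u)) ⟩
  sum (λ u → sum (upper (λ x y → iverson (D x y) ℕ.+ iverson (D y x)) u))
    ≤⟨ sum-mono (λ u → sum-mono (λ v → upper-edge u v)) ⟩
  sum (λ u → sum (λ v → iverson (lt u v ∧ adj G u v)))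
    ≡⟨ sum-cong-≗ (λ u → countTrue≡sum (λ v → lt u v ∧ adj G u v)) ⟨
  sum (λ u → countTrue (λ v → lt u v ∧ adj G u v))
    ≡⟨ sumℕ≡sum (λ u → countTrue (λ v → lt u v ∧ adj G u v)) ⟨
  numEdges G ∎
  where
  open ℕP.≤-Reasoning
  upper-edge : ∀ u v → upper (λ x y → iverson (D x y) ℕ.+ iverson (D y x)) u v
                         ℕ.≤ iverson (lt u v ∧ adj G u v)
  upper-edge u v with lt u v
  ... | true  = edge-counted-once po u v
  ... | false = ℕ.z≤n

anyTrue-witness : ∀ {n} (f : Fin n → Bool) → anyTrue f ≡ true → Σ (Fin n) λ x → f x ≡ true
anyTrue-witness {zero} f ()
anyTrue-witness {suc n} f any with f Fin.zero in f₀
... | true  = Fin.zero , f₀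
... | false with anyTrue-witness (f ∘ Fin.suc) any
...   | x , fx = Fin.suc x , fx

inEr-heavy : ∀ {n} s (D : DiEdges n) u v → inEr s D u v ≡ true →
  (D u v ≡ true) × ((s + s) ≤ ℕtoℚ (dout D u))
inEr-heavy s D u v e with D u v | (s + s) ≤? ℕtoℚ (dout D u)
... | true  | yes heavy = refl , heavy
... | true  | no _      = ⊥-elim (true≢false (≡-sym e))
... | false | _         = ⊥-elim (true≢false (≡-sym e))

tail-of-Er : ∀ {n} s (D : DiEdges n) u v → inEr s D u v ≡ true →
  (s + s) - 1ℚ ≤ ℕtoℚ (dout D u)
tail-of-Er s D u v e with inEr-heavy s D u v e
... | _ , heavy = ≤-trans (minus-one-≤ (s + s)) heavy

-- The head of an edge of E_r has out-degree at least 2s − 1 once no edge is reversible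
-- with threshold 2s: otherwise that very edge could be reversed.
head-of-Er : ∀ {n} s (D : DiEdges n) → (∀ u v → ¬ Reversible (s + s) D u v) →
  ∀ u v → inEr s D u v ≡ true → (s + s) - 1ℚ ≤ ℕtoℚ (dout D v)
head-of-Er s D stable u v e with inEr-heavy s D u v e
... | Duv , heavy = ≮⇒≥ (λ light → stable u v (Duv , heavy , light))

Vr-degree : ∀ {n} s (D : DiEdges n) → (∀ u v → ¬ Reversible (s + s) D u v) →
  ∀ w → inVr s D w ≡ true → (s + s) - 1ℚ ≤ ℕtoℚ (dout D w)
Vr-degree s D stable w e with anyTrue-witness (λ x → inEr s D w x ∨ inEr s D x w) e
... | x , incident with inEr s D w x in wx | inEr s D x w in xw
...   | true  | _     = tail-of-Er s D w x wx
...   | false | true  = head-of-Er s D stable x w xw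
...   | false | false = ⊥-elim (true≢false (≡-sym incident))

lemma8 : (n : ℕ) (G : Graph n) (s : ℚ) → 1ℚ < s →
    ℕtoℚ (numEdges G) ≤ s * ℕtoℚ n →
    (D : DiEdges n) → IsOutput G (s + s) D →
    ℕtoℚ (sizeVr s D) * ((s + s) - 1ℚ) ≤ s * ℕtoℚ n
lemma8 n G s _ |E|≤s|V| D ((D₀ , oriented , run) , stable) = begin
  ℕtoℚ (sizeVr s D) * ((s + s) - 1ℚ)
    ≤⟨ count-weighted ((s + s) - 1ℚ) (inVr s D) (dout D) (Vr-degree s D stable) ⟩
  ℕtoℚ (sum (dout D))
    ≤⟨ ℕtoℚ-mono (degree-sum-bound partial) ⟩
  ℕtoℚ (numEdges G)
    ≤⟨ |E|≤s|V| ⟩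
  s * ℕtoℚ n ∎
  where
  open ≤-Reasoning
  partial : IsPartialOrientation G D
  partial = run-preserves (s + s) (orientation⇒partial oriented) run
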